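{- Let $G$ be a complete signed graph on vertex set $V$, let $u\neq v$, and let $H$ be obtained from $G$ by flipping the sign of the pair $\{u,v\}$ (in either direction). Let $S=N_{G^+}(u)\cup N_{G^+}(v)\cup\{u,v\}$. Then $\mathrm{AgreeCnt}_{G^+}(w)=\mathrm{AgreeCnt}_{H^+}(w)$ for all $w\in V\setminus S$.
   Context: A complete signed graph on a finite vertex set $V$ assigns to every unordered pair of distinct vertices a sign $+$ or $-$. For such a graph $X$, its positive graph $X^+$ has vertex set $V$ and as edges the pairs of sign $+$; $N_{X^+}(a)$ is the open neighborhood of $a$ in $X^+$. Fix $\varepsilon>0$. $\mathrm{NonAgreement}_{X^+}(a,b)=\frac{|N_{X^+}(a)\,\Delta\,N_{X^+}(b)|}{\max\{|N_{X^+}(a)|,|N_{X^+}(b)|\}}$. Vertices $a,b$ are in $\varepsilon$-agreement in $X^+$ if $\{a,b\}$ is an edge of $X^+$ and $\mathrm{NonAgreement}_{X^+}(a,b)<\varepsilon$. $\mathrm{AgreeCnt}_{X^+}(a)$ is the number of vertices $b$ such that $a$ and $b$ are in $\varepsilon$-agreement in $X^+$.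
   Formalization: The parameter ε ranges over the positive rationals instead of the positive reals. -}

module Defs where

open import Data.Bool using (Bool; true; false; not; _∧_; if_then_else_)
open import Data.Nat using (ℕ; zero; suc; _⊔_)
open import Data.Integer using (+_)
open import Data.Fin using (Fin; _≟_)
open import Data.Fin.Subset using (Subset; _∪_; _─_; ∣_∣; ⁅_⁆)
open import Data.Vec using (tabulate)
open import Data.Rational using (ℚ; _/_; 0ℚ)
open import Data.Rational.Properties using (_<?_)
open import Relation.Nullary using (does; ¬_)
open import Relation.Binary.PropositionalEquality using (_≡_)

-- A complete signed graph on vertex set Fin n: sign a b = true means "+".
-- Values on the diagonal are irrelevant (never used).
SignedGraph : ℕ → Set
SignedGraph n = Fin n → Fin n → Bool

Symmetric : ∀ {n} → SignedGraph n → Set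
Symmetric {n} X = (a b : Fin n) → X a b ≡ X b a

posEdge : ∀ {n} → SignedGraph n → Fin n → Fin n → Bool
posEdge X a b = if does (a ≟ b) then false else X a b

N⁺ : ∀ {n} → SignedGraph n → Fin n → Subset n
N⁺ X a = tabulate (λ b → posEdge X a b)

_Δ_ : ∀ {n} → Subset n → Subset n → Subset n
A Δ B = (A ─ B) ∪ (B ─ A)

-- NonAgreement in X⁺ (the quotient; defined as 0 when both degrees are 0,
-- a case that never arises for ε-agreement since that requires an edge).
nonAgreement : ∀ {n} → SignedGraph n → Fin n → Fin n → ℚ
nonAgreement X a b with ∣ N⁺ X a ∣ ⊔ ∣ N⁺ X b ∣
... | zero  = 0ℚ
... | suc m = (+ ∣ N⁺ X a Δ N⁺ X b ∣) / suc m

agree : ∀ {n} → ℚ → SignedGraph n → Fin n → Fin n → Bool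
agree ε X a b = posEdge X a b ∧ does (nonAgreement X a b <? ε)

agreeCnt : ∀ {n} → ℚ → SignedGraph n → Fin n → ℕ
agreeCnt ε X a = ∣ tabulate (λ b → agree ε X a b) ∣

isPair : ∀ {n} → Fin n → Fin n → Fin n → Fin n → Bool
isPair u v x y =
  (does (x ≟ u) ∧ does (y ≟ v)) Data.Bool.∨ (does (x ≟ v) ∧ does (y ≟ u))

flipSign : ∀ {n} → SignedGraph n → Fin n → Fin n → SignedGraph n
flipSign X u v x y = if isPair u v x y then not (X x y) else X x y

bigS : ∀ {n} → SignedGraph n → Fin n → Fin n → Subset n
bigS G u v = N⁺ G u ∪ N⁺ G v ∪ ⁅ u ⁆ ∪ ⁅ v ⁆

-- Flipping the sign of {u,v} changes only the rows of u and v, and agreement of w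
-- with b depends only on the rows of w and b. A vertex w outside S is neither u nor
-- v, and every b in agreement with w is a positive neighbour of w, hence (by
-- symmetry and w ∉ N⁺(u) ∪ N⁺(v)) neither u nor v either.
module Submission where

open import Defs
open import Data.Bool using (Bool; true; false; _∧_; if_then_else_)
open import Data.Nat using (ℕ; zero; suc; _⊔_)
open import Data.Integer using (+_)
open import Data.Fin using (Fin; _≟_)
open import Data.Fin.Subset using (Subset; _∈_; _∉_; ∣_∣)
open import Data.Fin.Subset.Properties using (x∈p∪q⁺; x∈⁅x⁆)
open import Data.Rational using (ℚ; Positive; _/_; 0ℚ)
open import Data.Rational.Properties using (_<?_)
open import Data.Sum using (inj₁; inj₂)
open import Data.Vec using (tabulate; lookup)
open import Data.Vec.Properties using (tabulate-cong; lookup∘tabulate; lookup⇒[]=)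
open import Relation.Nullary using (¬_; does; yes; no; contradiction)
open import Relation.Binary.PropositionalEquality
  using (_≡_; _≢_; refl; sym; trans; cong; cong₂; module ≡-Reasoning)

private
  variable
    n : ℕ

∈-tabulate⁺ : (f : Fin n → Bool) {x : Fin n} → f x ≡ true → x ∈ tabulate f
∈-tabulate⁺ f {x} fx = lookup⇒[]= x (tabulate f) (trans (lookup∘tabulate f x) fx)

posEdge-cong : {X Y : SignedGraph n} {a : Fin n} → N⁺ X a ≡ N⁺ Y a →
  (b : Fin n) → posEdge X a b ≡ posEdge Y a b
posEdge-cong {X = X} {Y} {a} Na≡ b = begin
  posEdge X a b        ≡⟨ sym (lookup∘tabulate (posEdge X a) b) ⟩
  lookup (N⁺ X a) b    ≡⟨ cong (λ A → lookup A b) Na≡ ⟩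
  lookup (N⁺ Y a) b    ≡⟨ lookup∘tabulate (posEdge Y a) b ⟩
  posEdge Y a b        ∎
  where open ≡-Reasoning

posEdge-sym : {X : SignedGraph n} → Symmetric X → (a b : Fin n) → posEdge X a b ≡ posEdge X b a
posEdge-sym {X = X} X-sym a b with a ≟ b | b ≟ a
... | yes _   | yes _   = refl
... | yes a≡b | no b≢a  = contradiction (sym a≡b) b≢a
... | no a≢b  | yes b≡a = contradiction (sym b≡a) a≢b
... | no _    | no _    = X-sym a b

-- The with-abstraction inside nonAgreement blocks congruence in X directly; ratio
-- exhibits nonAgreement X a b as a function of the two neighbourhoods only.
ratio : Subset n → Subset n → ℚ
ratio A B with ∣ A ∣ ⊔ ∣ B ∣
... | zero  = 0ℚ
... | suc m = (+ ∣ A Δ B ∣) / suc m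

nonAgreement≡ratio : (X : SignedGraph n) (a b : Fin n) →
  nonAgreement X a b ≡ ratio (N⁺ X a) (N⁺ X b)
nonAgreement≡ratio X a b with ∣ N⁺ X a ∣ ⊔ ∣ N⁺ X b ∣
... | zero  = refl
... | suc _ = refl

nonAgreement-cong : {X Y : SignedGraph n} (a b : Fin n) →
  N⁺ X a ≡ N⁺ Y a → N⁺ X b ≡ N⁺ Y b → nonAgreement X a b ≡ nonAgreement Y a b
nonAgreement-cong {X = X} {Y} a b Na≡ Nb≡ = begin
  nonAgreement X a b         ≡⟨ nonAgreement≡ratio X a b ⟩
  ratio (N⁺ X a) (N⁺ X b)    ≡⟨ cong₂ ratio Na≡ Nb≡ ⟩
  ratio (N⁺ Y a) (N⁺ Y b)    ≡⟨ sym (nonAgreement≡ratio Y a b) ⟩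
  nonAgreement Y a b         ∎
  where open ≡-Reasoning

∧-cong-guarded : {x x′ y y′ : Bool} → x ≡ x′ → (x ≡ true → y ≡ y′) → x ∧ y ≡ x′ ∧ y′
∧-cong-guarded {false} refl _   = refl
∧-cong-guarded {true}  refl y≡y′ = y≡y′ refl

agree-cong : (ε : ℚ) {X Y : SignedGraph n} (a b : Fin n) →
  N⁺ X a ≡ N⁺ Y a → (posEdge X a b ≡ true → N⁺ X b ≡ N⁺ Y b) →
  agree ε X a b ≡ agree ε Y a b
agree-cong ε {X} {Y} a b Na≡ Nb≡ = ∧-cong-guarded (posEdge-cong {X = X} {Y} Na≡ b)
  (λ ab → cong (λ q → does (q <? ε)) (nonAgreement-cong {X = X} {Y} a b Na≡ (Nb≡ ab)))

agreeCnt-cong : (ε : ℚ) {X Y : SignedGraph n} (a : Fin n) →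
  N⁺ X a ≡ N⁺ Y a → (∀ b → posEdge X a b ≡ true → N⁺ X b ≡ N⁺ Y b) →
  agreeCnt ε X a ≡ agreeCnt ε Y a
agreeCnt-cong ε a Na≡ Nb≡ =
  cong ∣_∣ (tabulate-cong (λ b → agree-cong ε a b Na≡ (Nb≡ b)))

isPair-outside : {u v x : Fin n} → x ≢ u → x ≢ v → (y : Fin n) → isPair u v x y ≡ false
isPair-outside {u = u} {v} {x} x≢u x≢v y with x ≟ u | x ≟ v
... | yes x≡u | _       = contradiction x≡u x≢u
... | no _    | yes x≡v = contradiction x≡v x≢v
... | no _    | no _    = refl

N⁺-flipSign-outside : (G : SignedGraph n) {u v x : Fin n} → x ≢ u → x ≢ v →
  N⁺ (flipSign G u v) x ≡ N⁺ G x
N⁺-flipSign-outside G {u} {v} {x} x≢u x≢v = tabulate-cong λ y →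
  cong (if does (x ≟ y) then false else_) (flipSign-row y)
  where
  flipSign-row : ∀ y → flipSign G u v x y ≡ G x y
  flipSign-row y rewrite isPair-outside x≢u x≢v y = refl

module _ {G : SignedGraph n} {u v w : Fin n} (w∉S : w ∉ bigS G u v) where

  ∉bigS⇒≢ˡ : w ≢ u
  ∉bigS⇒≢ˡ refl = w∉S (x∈p∪q⁺ (inj₂ (x∈p∪q⁺ (inj₂ (x∈p∪q⁺ (inj₁ (x∈⁅x⁆ w)))))))

  ∉bigS⇒≢ʳ : w ≢ v
  ∉bigS⇒≢ʳ refl = w∉S (x∈p∪q⁺ (inj₂ (x∈p∪q⁺ (inj₂ (x∈p∪q⁺ (inj₂ (x∈⁅x⁆ w)))))))

  module _ (G-sym : Symmetric G) {b : Fin n} (wb : posEdge G w b ≡ true) where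

    private
      w∈N⁺b : w ∈ N⁺ G b
      w∈N⁺b = ∈-tabulate⁺ (posEdge G b) (trans (posEdge-sym G-sym b w) wb)

    ∉bigS⇒neighbour≢ˡ : b ≢ u
    ∉bigS⇒neighbour≢ˡ refl = w∉S (x∈p∪q⁺ (inj₁ w∈N⁺b))

    ∉bigS⇒neighbour≢ʳ : b ≢ v
    ∉bigS⇒neighbour≢ʳ refl = w∉S (x∈p∪q⁺ (inj₂ (x∈p∪q⁺ (inj₁ w∈N⁺b))))

corollary1 : (ε : ℚ) → Positive ε → (n : ℕ) → (G : SignedGraph n) → Symmetric G →
    (u v : Fin n) → ¬ (u ≡ v) → (w : Fin n) → w ∉ bigS G u v →
    agreeCnt ε G w ≡ agreeCnt ε (flipSign G u v) w
corollary1 ε _ n G G-sym u v _ w w∉S = agreeCnt-cong ε w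
  (sym (N⁺-flipSign-outside G (∉bigS⇒≢ˡ w∉S) (∉bigS⇒≢ʳ w∉S)))
  (λ b wb → sym (N⁺-flipSign-outside G
    (∉bigS⇒neighbour≢ˡ w∉S G-sym wb) (∉bigS⇒neighbour≢ʳ w∉S G-sym wb)))
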